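{- Let $q$ be a prime power, $n$ a positive integer, $\sigma:\mathbb{F}_{q^n}\to\mathbb{F}_{q^n}$ the Frobenius map $\sigma(x)=x^q$, and $\operatorname{Tr}:\mathbb{F}_{q^n}\to\mathbb{F}_q$ the trace. For nonzero $\alpha\in\mathbb{F}_{q^n}$ let $V_\alpha=\{x\in\mathbb{F}_{q^n}:\operatorname{Tr}(\alpha x)=0\}$. (i) If $\alpha,\sigma(\alpha),\dots,\sigma^{n-1}(\alpha)$ are linearly independent over $\mathbb{F}_q$, then $V_\alpha$ is not a cyclically covering subspace of $\mathbb{F}_{q^n}$. (ii) Let $\alpha,\sigma(\alpha),\dots,\sigma^{t-1}(\alpha)$ be a maximal $\mathbb{F}_q$-linearly independent subset of $\{\alpha,\sigma(\alpha),\dots,\sigma^{n-1}(\alpha)\}$, and for each $i$ write $\sigma^i(\alpha)=k_{i1}\alpha+k_{i2}\sigma(\alpha)+\dots+k_{it}\sigma^{t-1}(\alpha)$ with $k_{ij}\in\mathbb{F}_q$. Then $V_\alpha$ is a cyclically covering subspace of $\mathbb{F}_{q^n}$ if and only if for every $(x_1,\dots,x_t)\in(\mathbb{F}_q^*)^t$ there exists an integer $i$ with $t\le i\le n-1$ such that \[k_{i1}x_1+k_{i2}x_2+\dots+k_{it}x_t=0.\]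
   Context: A subspace $U$ of the $\mathbb{F}_q$-vector space $\mathbb{F}_{q^n}$ is cyclically covering if $\bigcup_{i=0}^{n-1}\sigma^i(U)=\mathbb{F}_{q^n}$, where $\sigma$ is the Frobenius map $x\mapsto x^q$. -}

module Defs where

open import Level using (Level; _⊔_)
open import Data.Nat as ℕ using (ℕ; zero; suc; _≤_; _<_)
open import Data.Nat.Primality using (Prime)
open import Data.Fin using (Fin; toℕ)
import Data.Fin as Fin
open import Data.Product using (Σ; ∃; ∃-syntax; _×_; _,_)
open import Relation.Nullary using (¬_)
open import Relation.Binary.PropositionalEquality using (_≡_)
open import Algebra.Bundles using (CommutativeRing)

IsPrimePower : ℕ → Set
IsPrimePower q = ∃[ p ] ∃[ m ] (Prime p × 1 ≤ m × q ≡ p ℕ.^ m)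

module FieldDefs {c ℓ : Level} (K : CommutativeRing c ℓ) where
  open CommutativeRing K

  pow : Carrier → ℕ → Carrier
  pow x zero    = 1#
  pow x (suc k) = x * pow x k

  sumFin : (m : ℕ) → (Fin m → Carrier) → Carrier
  sumFin zero    f = 0#
  sumFin (suc m) f = f Fin.zero + sumFin m (λ i → f (Fin.suc i))

  IsField : Set (c ⊔ ℓ)
  IsField = (¬ (0# ≈ 1#)) × (∀ x → ¬ (x ≈ 0#) → ∃[ y ] (x * y ≈ 1#))

  HasCard : ℕ → Set (c ⊔ ℓ)
  HasCard N = Σ (Fin N → Carrier) λ e →
                (∀ i j → e i ≈ e j → i ≡ j) × (∀ x → ∃[ i ] (e i ≈ x))

  module WithQ (q n : ℕ) where
    InFq : Carrier → Set ℓ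
    InFq x = pow x q ≈ x

    σ : Carrier → Carrier
    σ x = pow x q

    σ^ : ℕ → Carrier → Carrier
    σ^ zero    x = x
    σ^ (suc i) x = σ (σ^ i x)

    Tr : Carrier → Carrier
    Tr x = sumFin n (λ i → σ^ (toℕ i) x)

    V : Carrier → Carrier → Set ℓ
    V α x = Tr (α * x) ≈ 0#

    LinIndep : (m : ℕ) → (Fin m → Carrier) → Set (c ⊔ ℓ)
    LinIndep m v = (a : Fin m → Carrier) → (∀ j → InFq (a j)) →
                   sumFin m (λ j → a j * v j) ≈ 0# → ∀ j → a j ≈ 0#

    CyclicallyCovering : (Carrier → Set ℓ) → Set (c ⊔ ℓ)
    CyclicallyCovering U = ∀ x → ∃[ i ] (i < n × ∃[ u ] (U u × σ^ i u ≈ x))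

module Submission where

-- Tr (x y) is an F_q-bilinear pairing on F_{q^n} that is invariant under σ and nondegenerate (Tr is a
-- polynomial of degree q^(n-1) < q^n, so it is not identically zero). Invariance gives σ^i(V_α) =
-- { y : Tr (σ^i(α) y) = 0 }, so V_α is cyclically covering iff every y is orthogonal to some σ^i(α) with
-- i < n. For (i) take y = 1: then Tr α = Σ_i σ^i(α) = 0, a dependence with all coefficients 1. For (ii),
-- Tr (σ^i(α) y) = Σ_j k_ij x_j with x_j = Tr (σ^j(α) y); by nondegeneracy the σ^j(α), j < t, have a dual
-- basis, so (x_j) runs over all of F_q^t, and for i < t the relation Σ_j k_ij x_j = 0 just says x_i = 0.
-- The finite-field facts behind this (characteristic p, x^(q^n) = x, σ additive) are derived from the
-- cardinality q^n alone.

open import Defs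
open import Level using (Level)
open import Algebra.Bundles using (CommutativeRing; CommutativeMonoid)
import Algebra.Properties.CommutativeMonoid.Sum
open import Data.Fin as Fin using (Fin; toℕ; inject₁; fromℕ; fromℕ<)
import Data.Fin.Properties as Fin
open import Data.List using (List; []; _∷_; length)
open import Data.List.Relation.Unary.All using (All; []; _∷_)
open import Data.Nat as ℕ using (ℕ; zero; suc; z≤n; s≤s; _≤_; _<_; _^_; _∸_; _!; NonZero)
import Data.Nat.Properties as ℕ
open import Data.Nat.Combinatorics using (_C_; nCk≡n!/k![n-k]!; k![n∸k]!∣n!; nCn≡1)
open import Data.Nat.Divisibility using (_∣_; divides; >⇒∤; ∣1⇒≡1; ∣m⇒∣m*n; ∣-refl)
open import Data.Nat.DivMod using (m/n*n≡m)
open import Data.Nat.Primality using (Prime; euclidsLemma; prime⇒nonTrivial; prime⇒nonZero)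
open import Data.Product using (∃; ∃-syntax; _×_; _,_; proj₁; proj₂; map)
open import Data.Sum using (inj₁; inj₂)
open import Function.Base using (_∘_; id)
open import Function.Bundles using (_⇔_; Equivalence; mk⇔)
open import Relation.Binary.PropositionalEquality as ≡ using (_≡_; _≢_)
open import Relation.Nullary using (¬_; contradiction)

prime⇒1<p : ∀ {p} → Prime p → 1 < p
prime⇒1<p {p} pr = ℕ.nonTrivial⇒n>1 p {{prime⇒nonTrivial pr}}

prime∤! : ∀ {p} → Prime p → ∀ j → j < p → ¬ p ∣ j !
prime∤! pr zero    _   p∣1 = ℕ.<⇒≢ (prime⇒1<p pr) (≡.sym (∣1⇒≡1 p∣1))
prime∤! pr (suc j) j<p p∣j! with euclidsLemma (suc j) (j !) pr p∣j!
... | inj₁ p∣1+j = >⇒∤ j<p p∣1+j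
... | inj₂ p∣j!′ = prime∤! pr j (ℕ.<-trans (ℕ.n<1+n j) j<p) p∣j!′

n∣n! : ∀ n → .{{NonZero n}} → n ∣ n !
n∣n! (suc n) = ∣m⇒∣m*n (n !) ∣-refl

-- p divides p! = (p C k) * (k! * (p ∸ k)!), but neither factorial.
prime∣C : ∀ {p k} → Prime p → 0 < k → k < p → p ∣ p C k
prime∣C {p} {k} pr 0<k k<p
  with euclidsLemma (p C k) d pr (≡.subst (p ∣_) (≡.sym C*d≡p!) (n∣n! p {{prime⇒nonZero pr}}))
  where
  d = k ! ℕ.* (p ∸ k) !
  C*d≡p! : (p C k) ℕ.* d ≡ p !
  C*d≡p! = ≡.trans (≡.cong (ℕ._* d) (nCk≡n!/k![n-k]! (ℕ.<⇒≤ k<p)))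
                   (m/n*n≡m {{k ℕ.!* (p ∸ k) !≢0}} (k![n∸k]!∣n! (ℕ.<⇒≤ k<p)))
... | inj₁ p∣C = p∣C
... | inj₂ p∣d with euclidsLemma (k !) ((p ∸ k) !) pr p∣d
...   | inj₁ p∣k! = contradiction p∣k! (prime∤! pr k k<p)
...   | inj₂ p∣[p∸k]! =
  contradiction p∣[p∸k]! (prime∤! pr (p ∸ k) (ℕ.∸-monoʳ-< {p} {k} {0} 0<k (ℕ.<⇒≤ k<p)))

module CommutativeRingProperties {c ℓ} (K : CommutativeRing c ℓ) where
  open CommutativeRing K
  open FieldDefs K
  open import Relation.Binary.Reasoning.Setoid setoid
  open import Data.Vec.Functional using (tail; init; last)
  open import Algebra.Properties.Ring ring using (-1*x≈-x)
  open import Algebra.Properties.Group +-group using (\\-leftDividesˡ)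
  open import Algebra.Properties.Semiring.Sum semiring
    using (sum; sum-cong-≋; ∑-distrib-+; *-distribˡ-sum; sum-init-last; sum-replicate-zero)
  open import Algebra.Properties.Semiring.Mult semiring
    using (×-homo-1; ×-congʳ; ×-assoc-*; ×1-homo-*) renaming (_×_ to _·_)
  import Algebra.Properties.CommutativeSemiring.Exp commutativeSemiring as Exp
  import Algebra.Properties.CommutativeSemiring.Binomial commutativeSemiring as Binomial
  open import Algebra.Solver.Ring.NaturalCoefficients.Default commutativeSemiring
    using (solve; _:=_; _:+_; _:*_)

  sumFin≡sum : ∀ m (f : Fin m → Carrier) → sumFin m f ≡ sum f
  sumFin≡sum zero    f = ≡.refl
  sumFin≡sum (suc m) f = ≡.cong (f Fin.zero +_) (sumFin≡sum m (λ i → f (Fin.suc i)))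

  sumFin-cong : ∀ m {f g : Fin m → Carrier} → (∀ i → f i ≈ g i) → sumFin m f ≈ sumFin m g
  sumFin-cong m {f} {g} f≈g rewrite sumFin≡sum m f | sumFin≡sum m g = sum-cong-≋ f≈g

  sumFin-zero : ∀ m → sumFin m (λ _ → 0#) ≈ 0#
  sumFin-zero m rewrite sumFin≡sum m (λ _ → 0#) = sum-replicate-zero m

  sumFin-distrib-+ : ∀ m (f g : Fin m → Carrier) →
                     sumFin m (λ i → f i + g i) ≈ sumFin m f + sumFin m g
  sumFin-distrib-+ m f g
    rewrite sumFin≡sum m (λ i → f i + g i) | sumFin≡sum m f | sumFin≡sum m g = ∑-distrib-+ f g

  *-distribˡ-sumFin : ∀ m x (f : Fin m → Carrier) → x * sumFin m f ≈ sumFin m (λ i → x * f i)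
  *-distribˡ-sumFin m x f
    rewrite sumFin≡sum m f | sumFin≡sum m (λ i → x * f i) = *-distribˡ-sum x f

  sumFin-last : ∀ m (g : ℕ → Carrier) →
                sumFin (suc m) (λ i → g (toℕ i)) ≈ sumFin m (λ i → g (toℕ i)) + g m
  sumFin-last m g
    rewrite sumFin≡sum (suc m) (λ i → g (toℕ i)) | sumFin≡sum m (λ i → g (toℕ i)) = begin
    sum {suc m} (λ i → g (toℕ i))                            ≈⟨ sum-init-last (λ i → g (toℕ i)) ⟩
    sum {m} (λ i → g (toℕ (inject₁ i))) + g (toℕ (fromℕ m))
      ≈⟨ +-cong (sum-cong-≋ {m} (λ i → reflexive (≡.cong g (Fin.toℕ-inject₁ i))))
                (reflexive (≡.cong g (Fin.toℕ-fromℕ m))) ⟩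
    sum {m} (λ i → g (toℕ i)) + g m                          ∎

  sumFin-shift : ∀ m (f : ℕ → Carrier) → f m ≈ f 0 →
                 sumFin m (λ i → f (suc (toℕ i))) ≈ sumFin m (λ i → f (toℕ i))
  sumFin-shift zero    f _       = refl
  sumFin-shift (suc m) f fm≈f0 = begin
    sumFin (suc m) (λ i → f (suc (toℕ i)))       ≈⟨ sumFin-last m (λ i → f (suc i)) ⟩
    sumFin m (λ i → f (suc (toℕ i))) + f (suc m) ≈⟨ +-comm _ _ ⟩
    f (suc m) + sumFin m (λ i → f (suc (toℕ i))) ≈⟨ +-congʳ fm≈f0 ⟩
    f 0 + sumFin m (λ i → f (suc (toℕ i)))       ∎

  sumFin-negate : ∀ m (f : Fin m → Carrier) → sumFin m (λ i → - f i) ≈ - sumFin m f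
  sumFin-negate m f = begin
    sumFin m (λ i → - f i)        ≈⟨ sumFin-cong m (λ i → -1*x≈-x (f i)) ⟨
    sumFin m (λ i → - 1# * f i)   ≈⟨ *-distribˡ-sumFin m (- 1#) f ⟨
    - 1# * sumFin m f             ≈⟨ -1*x≈-x _ ⟩
    - sumFin m f                  ∎

  δ : ∀ {m} → Fin m → Fin m → Carrier
  δ Fin.zero    Fin.zero    = 1#
  δ Fin.zero    (Fin.suc _) = 0#
  δ (Fin.suc _) Fin.zero    = 0#
  δ (Fin.suc i) (Fin.suc j) = δ i j

  sumFin-δ : ∀ m (i : Fin m) (f : Fin m → Carrier) → sumFin m (λ j → δ i j * f j) ≈ f i
  sumFin-δ (suc m) Fin.zero f = begin
    1# * f Fin.zero + sumFin m (λ j → 0# * f (Fin.suc j))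
      ≈⟨ +-cong (*-identityˡ _) (sumFin-cong m (λ j → zeroˡ _)) ⟩
    f Fin.zero + sumFin m (λ _ → 0#)                      ≈⟨ +-congˡ (sumFin-zero m) ⟩
    f Fin.zero + 0#                                       ≈⟨ +-identityʳ _ ⟩
    f Fin.zero                                            ∎
  sumFin-δ (suc m) (Fin.suc i) f = begin
    0# * f Fin.zero + sumFin m (λ j → δ i j * f (Fin.suc j)) ≈⟨ +-congʳ (zeroˡ _) ⟩
    0# + sumFin m (λ j → δ i j * f (Fin.suc j))              ≈⟨ +-identityˡ _ ⟩
    sumFin m (λ j → δ i j * f (Fin.suc j))                   ≈⟨ sumFin-δ m i (λ j → f (Fin.suc j)) ⟩
    f (Fin.suc i)                                            ∎

  pow≡^ : ∀ x k → pow x k ≡ x Exp.^ k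
  pow≡^ x zero    = ≡.refl
  pow≡^ x (suc k) = ≡.cong (x *_) (pow≡^ x k)

  pow-congˡ : ∀ k {x y} → x ≈ y → pow x k ≈ pow y k
  pow-congˡ k {x} {y} x≈y rewrite pow≡^ x k | pow≡^ y k = Exp.^-congˡ k x≈y

  pow-distrib-* : ∀ x y k → pow (x * y) k ≈ pow x k * pow y k
  pow-distrib-* x y k rewrite pow≡^ (x * y) k | pow≡^ x k | pow≡^ y k = Exp.^-distrib-* x y k

  pow-assocʳ : ∀ x m n → pow (pow x m) n ≈ pow x (m ℕ.* n)
  pow-assocʳ x m n rewrite pow≡^ (pow x m) n | pow≡^ x m | pow≡^ x (m ℕ.* n) = Exp.^-assocʳ x m n

  pow-identityˡ : ∀ k → pow 1# k ≈ 1#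
  pow-identityˡ zero    = refl
  pow-identityˡ (suc k) = trans (*-identityˡ _) (pow-identityˡ k)

  pow-zeroˡ : ∀ k .{{_ : NonZero k}} → pow 0# k ≈ 0#
  pow-zeroˡ (suc k) = zeroˡ _

  ·1-homo-^ : ∀ a k → (a ℕ.^ k) · 1# ≈ pow (a · 1#) k
  ·1-homo-^ a zero    = +-identityʳ 1#
  ·1-homo-^ a (suc k) = trans (×1-homo-* a (a ℕ.^ k)) (*-congˡ (·1-homo-^ a k))

  ∣⇒·≈0 : ∀ {p m} → p · 1# ≈ 0# → p ∣ m → ∀ z → m · z ≈ 0#
  ∣⇒·≈0 {p} {m} p·1≈0 (divides d ≡.refl) z = begin
    (d ℕ.* p) · z               ≈⟨ ×-congʳ (d ℕ.* p) (*-identityˡ z) ⟨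
    (d ℕ.* p) · (1# * z)        ≈⟨ ×-assoc-* (d ℕ.* p) 1# z ⟨
    ((d ℕ.* p) · 1#) * z        ≈⟨ *-congʳ (×1-homo-* d p) ⟩
    ((d · 1#) * (p · 1#)) * z   ≈⟨ *-congʳ (*-congˡ p·1≈0) ⟩
    ((d · 1#) * 0#) * z         ≈⟨ *-congʳ (zeroʳ _) ⟩
    0# * z                      ≈⟨ zeroˡ z ⟩
    0#                          ∎

  -- Only the two outer terms of the binomial expansion survive, since p divides the others.
  pow-+-prime : ∀ {p} → Prime p → p · 1# ≈ 0# → ∀ x y → pow (x + y) p ≈ pow x p + pow y p
  pow-+-prime {p@(suc p′)} pr p·1≈0 x y = begin
    pow (x + y) p                                       ≡⟨ pow≡^ (x + y) p ⟩
    (x + y) Exp.^ p                                     ≈⟨ Binomial.theorem p x y ⟩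
    b Fin.zero + sum (tail b)                           ≈⟨ +-congˡ (sum-init-last (tail b)) ⟩
    b Fin.zero + (sum (init (tail b)) + last (tail b))  ≈⟨ +-congˡ (+-congʳ (trans (sum-cong-≋ {p′} middle)
                                                                                      (sum-replicate-zero p′))) ⟩
    b Fin.zero + (0# + last (tail b))                   ≈⟨ +-cong outerʳ (trans (+-identityˡ _) outerˡ) ⟩
    pow y p + pow x p                                   ≈⟨ +-comm _ _ ⟩
    pow x p + pow y p                                   ∎
    where
    b : Fin (suc p) → Carrier
    b = Binomial.binomialTerm x y p
    middle : ∀ (i : Fin p′) → init (tail b) i ≈ 0#
    middle i = ∣⇒·≈0 p·1≈0 (prime∣C pr (s≤s z≤n)
                 (s≤s (≡.subst (ℕ._< p′) (≡.sym (Fin.toℕ-inject₁ i)) (Fin.toℕ<n i)))) _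
    outerʳ : b Fin.zero ≈ pow y p
    outerʳ = trans (×-homo-1 _) (trans (*-identityˡ _) (reflexive (≡.sym (pow≡^ y p))))
    outerˡ : last (tail b) ≈ pow x p
    outerˡ rewrite Fin.toℕ-fromℕ p′ | nCn≡1 p | ℕ.n∸n≡0 p =
      trans (×-homo-1 _) (trans (*-identityʳ _) (reflexive (≡.sym (pow≡^ x p))))

  pow-+-prime^ : ∀ {p} → Prime p → p · 1# ≈ 0# → ∀ m x y →
                 pow (x + y) (p ℕ.^ m) ≈ pow x (p ℕ.^ m) + pow y (p ℕ.^ m)
  pow-+-prime^ pr p·1≈0 zero    x y = trans (*-identityʳ _) (sym (+-cong (*-identityʳ x) (*-identityʳ y)))
  pow-+-prime^ {p} pr p·1≈0 (suc m) x y = begin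
    pow (x + y) (p ℕ.* p ℕ.^ m)                         ≈⟨ pow-assocʳ (x + y) p (p ℕ.^ m) ⟨
    pow (pow (x + y) p) (p ℕ.^ m)                       ≈⟨ pow-congˡ (p ℕ.^ m) (pow-+-prime pr p·1≈0 x y) ⟩
    pow (pow x p + pow y p) (p ℕ.^ m)                   ≈⟨ pow-+-prime^ pr p·1≈0 m (pow x p) (pow y p) ⟩
    pow (pow x p) (p ℕ.^ m) + pow (pow y p) (p ℕ.^ m)
      ≈⟨ +-cong (pow-assocʳ x p (p ℕ.^ m)) (pow-assocʳ y p (p ℕ.^ m)) ⟩
    pow x (p ℕ.* p ℕ.^ m) + pow y (p ℕ.* p ℕ.^ m)       ∎

  -- Polynomials as coefficient lists, constant term first.
  eval : List Carrier → Carrier → Carrier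
  eval []       x = 0#
  eval (a ∷ as) x = a + x * eval as x

  -- The quotient of division by X − r (synthetic division).
  divLinear : Carrier → List Carrier → List Carrier
  divLinear r []           = []
  divLinear r (a ∷ [])     = []
  divLinear r (a ∷ b ∷ bs) = eval (b ∷ bs) r ∷ divLinear r (b ∷ bs)

  length-divLinear : ∀ r as → length (divLinear r as) ≡ ℕ.pred (length as)
  length-divLinear r []           = ≡.refl
  length-divLinear r (a ∷ [])     = ≡.refl
  length-divLinear r (a ∷ b ∷ bs) = ≡.cong suc (length-divLinear r (b ∷ bs))

  eval-divLinear : ∀ r as x → eval as x ≈ eval as r + (x - r) * eval (divLinear r as) x
  eval-divLinear r [] x = sym (trans (+-identityˡ _) (zeroʳ _))
  eval-divLinear r (a ∷ []) x = begin
    a + x * 0#                    ≈⟨ +-congˡ (trans (zeroʳ x) (sym (zeroʳ r))) ⟩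
    a + r * 0#                    ≈⟨ +-identityʳ _ ⟨
    (a + r * 0#) + 0#             ≈⟨ +-congˡ (zeroʳ _) ⟨
    (a + r * 0#) + (x - r) * 0#   ∎
  eval-divLinear r (a ∷ b ∷ bs) x = begin
    a + x * eval bs′ x                  ≈⟨ +-congˡ (*-cong x≈r+d (eval-divLinear r (b ∷ bs) x)) ⟩
    a + (r + d) * (R + d * Q)           ≈⟨ solve 5 (λ a r d R Q → a :+ (r :+ d) :* (R :+ d :* Q) :=
                                                   (a :+ r :* R) :+ d :* (R :+ (r :+ d) :* Q)) refl a r d R Q ⟩
    (a + r * R) + d * (R + (r + d) * Q) ≈⟨ +-congˡ (*-congˡ (+-congˡ (*-congʳ x≈r+d))) ⟨
    (a + r * R) + d * (R + x * Q)       ∎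
    where
    bs′ = b ∷ bs
    d = x - r
    R = eval bs′ r
    Q = eval (divLinear r bs′) x
    x≈r+d : x ≈ r + (x - r)
    x≈r+d = trans (sym (\\-leftDividesˡ r x)) (+-congˡ (+-comm (- r) x))

  divLinear-allZero : ∀ r as → All (_≈ 0#) (divLinear r as) → eval as r ≈ 0# → All (_≈ 0#) as
  divLinear-allZero r []           _ _ = []
  divLinear-allZero r (a ∷ [])     _ a+r0≈0 = trans (sym (trans (+-congˡ (zeroʳ r)) (+-identityʳ a))) a+r0≈0 ∷ []
  divLinear-allZero r (a ∷ b ∷ bs) (R≈0 ∷ Q≈0) eval≈0 = a≈0 ∷ divLinear-allZero r (b ∷ bs) Q≈0 R≈0
    where
    a≈0 : a ≈ 0#
    a≈0 = begin
      a                      ≈⟨ +-identityʳ a ⟨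
      a + 0#                 ≈⟨ +-congˡ (trans (*-congˡ R≈0) (zeroʳ r)) ⟨
      a + r * eval (b ∷ bs) r ≈⟨ eval≈0 ⟩
      0#                     ∎

  _⊕_ : List Carrier → List Carrier → List Carrier
  []       ⊕ bs       = bs
  (a ∷ as) ⊕ []       = a ∷ as
  (a ∷ as) ⊕ (b ∷ bs) = (a + b) ∷ (as ⊕ bs)

  X^ : ℕ → List Carrier
  X^ zero    = 1# ∷ []
  X^ (suc k) = 0# ∷ X^ k

  eval-⊕ : ∀ as bs x → eval (as ⊕ bs) x ≈ eval as x + eval bs x
  eval-⊕ []       bs       x = sym (+-identityˡ _)
  eval-⊕ (a ∷ as) []       x = sym (+-identityʳ _)
  eval-⊕ (a ∷ as) (b ∷ bs) x = begin
    (a + b) + x * eval (as ⊕ bs) x            ≈⟨ +-congˡ (*-congˡ (eval-⊕ as bs x)) ⟩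
    (a + b) + x * (eval as x + eval bs x)     ≈⟨ solve 5 (λ a b x u v → (a :+ b) :+ x :* (u :+ v) :=
                                                          (a :+ x :* u) :+ (b :+ x :* v)) refl a b x _ _ ⟩
    (a + x * eval as x) + (b + x * eval bs x) ∎

  eval-X^ : ∀ k x → eval (X^ k) x ≈ pow x k
  eval-X^ zero    x = trans (+-congˡ (zeroʳ x)) (+-identityʳ 1#)
  eval-X^ (suc k) x = trans (+-identityˡ _) (*-congˡ (eval-X^ k x))

  length-X^ : ∀ k → length (X^ k) ≡ suc k
  length-X^ zero    = ≡.refl
  length-X^ (suc k) = ≡.cong suc (length-X^ k)

  length-⊕ : ∀ as bs {k} → length as ≤ k → length bs ≤ k → length (as ⊕ bs) ≤ k
  length-⊕ []       bs       _         bs≤k      = bs≤k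
  length-⊕ (a ∷ as) []       as≤k      _         = as≤k
  length-⊕ (a ∷ as) (b ∷ bs) (s≤s as≤k) (s≤s bs≤k) = s≤s (length-⊕ as bs as≤k bs≤k)

  allZero-⊕-X^⇒1≈0 : ∀ as k → length as ≤ k → All (_≈ 0#) (as ⊕ X^ k) → 1# ≈ 0#
  allZero-⊕-X^⇒1≈0 []       zero    _          (1≈0 ∷ _) = 1≈0
  allZero-⊕-X^⇒1≈0 []       (suc k) _          (_ ∷ zs)  = allZero-⊕-X^⇒1≈0 [] k z≤n zs
  allZero-⊕-X^⇒1≈0 (a ∷ as) (suc k) (s≤s as≤k) (_ ∷ zs)  = allZero-⊕-X^⇒1≈0 as k as≤k zs

module FieldProperties {c ℓ} (K : CommutativeRing c ℓ) (isField : FieldDefs.IsField K) where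
  open CommutativeRing K
  open FieldDefs K
  open CommutativeRingProperties K
  open import Relation.Binary.Reasoning.Setoid setoid
  open import Algebra.Properties.Ring ring using (x[y-z]≈xy-xz)
  open import Algebra.Properties.Group +-group using (x∙y⁻¹≈ε⇒x≈y; x≈y⇒x∙y⁻¹≈ε)

  1≉0 : 1# ≉ 0#
  1≉0 1≈0 = proj₁ isField (sym 1≈0)

  _⁻¹[_] : (x : Carrier) → x ≉ 0# → Carrier
  x ⁻¹[ x≉0 ] = proj₁ (proj₂ isField x x≉0)

  *-inverseʳ : ∀ x (x≉0 : x ≉ 0#) → x * x ⁻¹[ x≉0 ] ≈ 1#
  *-inverseʳ x x≉0 = proj₂ (proj₂ isField x x≉0)

  x*y≈0⇒y≈0 : ∀ {x y} → x ≉ 0# → x * y ≈ 0# → y ≈ 0#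
  x*y≈0⇒y≈0 {x} {y} x≉0 xy≈0 = begin
    y                        ≈⟨ *-identityˡ y ⟨
    1# * y                   ≈⟨ *-congʳ (trans (*-comm _ _) (*-inverseʳ x x≉0)) ⟨
    (x ⁻¹[ x≉0 ] * x) * y    ≈⟨ *-assoc _ _ _ ⟩
    x ⁻¹[ x≉0 ] * (x * y)    ≈⟨ *-congˡ xy≈0 ⟩
    x ⁻¹[ x≉0 ] * 0#         ≈⟨ zeroʳ _ ⟩
    0#                       ∎

  x*[x⁻¹*y]≈y : ∀ x (x≉0 : x ≉ 0#) y → x * (x ⁻¹[ x≉0 ] * y) ≈ y
  x*[x⁻¹*y]≈y x x≉0 y = trans (sym (*-assoc _ _ _)) (trans (*-congʳ (*-inverseʳ x x≉0)) (*-identityˡ y))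

  x⁻¹*[x*y]≈y : ∀ x (x≉0 : x ≉ 0#) y → x ⁻¹[ x≉0 ] * (x * y) ≈ y
  x⁻¹*[x*y]≈y x x≉0 y = trans (sym (*-assoc _ _ _))
                          (trans (*-congʳ (trans (*-comm _ _) (*-inverseʳ x x≉0))) (*-identityˡ y))

  *-≉0 : ∀ {x y} → x ≉ 0# → y ≉ 0# → x * y ≉ 0#
  *-≉0 x≉0 y≉0 xy≈0 = y≉0 (x*y≈0⇒y≈0 x≉0 xy≈0)

  pow-≉0 : ∀ {x} k → x ≉ 0# → pow x k ≉ 0#
  pow-≉0 zero    _   = 1≉0
  pow-≉0 (suc k) x≉0 = *-≉0 x≉0 (pow-≉0 k x≉0)

  *-cancelˡ : ∀ {x y z} → x ≉ 0# → x * y ≈ x * z → y ≈ z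
  *-cancelˡ {x} {y} {z} x≉0 xy≈xz =
    x∙y⁻¹≈ε⇒x≈y y z (x*y≈0⇒y≈0 x≉0 (trans (x[y-z]≈xy-xz x y z) (x≈y⇒x∙y⁻¹≈ε xy≈xz)))

  roots⇒allZero : ∀ as L → length as ≤ L → (rs : Fin L → Carrier) →
                  (∀ i j → rs i ≈ rs j → i ≡ j) → (∀ i → eval as (rs i) ≈ 0#) → All (_≈ 0#) as
  roots⇒allZero []       L       _          rs _      _     = []
  roots⇒allZero (a ∷ as) (suc L) (s≤s as≤L) rs rs-inj roots =
    divLinear-allZero r (a ∷ as)
      (roots⇒allZero (divLinear r (a ∷ as)) L length≤L (λ i → rs (Fin.suc i))
        (λ i j eq → Fin.suc-injective (rs-inj _ _ eq)) quotient-roots)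
      (roots Fin.zero)
    where
    r = rs Fin.zero
    length≤L : length (divLinear r (a ∷ as)) ≤ L
    length≤L = ≡.subst (_≤ L) (≡.sym (length-divLinear r (a ∷ as))) as≤L
    quotient-roots : ∀ i → eval (divLinear r (a ∷ as)) (rs (Fin.suc i)) ≈ 0#
    quotient-roots i = x*y≈0⇒y≈0 x-r≉0 (begin
      (x - r) * Q                 ≈⟨ +-identityˡ _ ⟨
      0# + (x - r) * Q            ≈⟨ +-congʳ (roots Fin.zero) ⟨
      eval (a ∷ as) r + (x - r) * Q ≈⟨ eval-divLinear r (a ∷ as) x ⟨
      eval (a ∷ as) x             ≈⟨ roots (Fin.suc i) ⟩
      0#                          ∎)
      where
      x = rs (Fin.suc i)
      Q = eval (divLinear r (a ∷ as)) x
      x-r≉0 : x - r ≉ 0#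
      x-r≉0 x-r≈0 with rs-inj (Fin.suc i) Fin.zero (x∙y⁻¹≈ε⇒x≈y x r x-r≈0)
      ... | ()

module FiniteFieldProperties {c ℓ} (K : CommutativeRing c ℓ) (isField : FieldDefs.IsField K)
                             {N : ℕ} (card : FieldDefs.HasCard K N) where
  open CommutativeRing K
  open FieldDefs K
  open CommutativeRingProperties K
  open FieldProperties K isField
  open import Relation.Binary.Reasoning.Setoid setoid
  open import Algebra.Properties.Group +-group using (identityˡ-unique; \\-leftDividesˡ; \\-leftDividesʳ)
  open import Algebra.Properties.Semiring.Mult semiring using () renaming (_×_ to _·_)
  open import Function.Definitions using (Congruent)
  open import Data.Fin.Permutation using (Permutation; permutation)
  open import Data.Vec.Functional using (removeAt)
  open import Algebra.Solver.Ring.NaturalCoefficients.Default commutativeSemiring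
    using (solve; _:=_; _:*_)
  open import Relation.Binary.Definitions using (Decidable)
  open import Relation.Nullary using (Dec; yes; no)

  e : Fin N → Carrier
  e = proj₁ card

  e-injective : ∀ i j → e i ≈ e j → i ≡ j
  e-injective = proj₁ (proj₂ card)

  index : Carrier → Fin N
  index x = proj₁ (proj₂ (proj₂ card) x)

  e-index : ∀ x → e (index x) ≈ x
  e-index x = proj₂ (proj₂ (proj₂ card) x)

  _≟_ : Decidable _≈_
  x ≟ y with index x Fin.≟ index y
  ... | yes i≡j = yes (trans (sym (e-index x)) (trans (reflexive (≡.cong e i≡j)) (e-index y)))
  ... | no  i≢j = no (λ x≈y → i≢j (e-injective _ _ (trans (e-index x) (trans x≈y (sym (e-index y))))))

  module _ (T T⁻¹ : Carrier → Carrier) (T-cong : Congruent _≈_ _≈_ T) (T⁻¹-cong : Congruent _≈_ _≈_ T⁻¹)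
           (T∘T⁻¹ : ∀ y → T (T⁻¹ y) ≈ y) (T⁻¹∘T : ∀ y → T⁻¹ (T y) ≈ y) where

    permute : Permutation N N
    permute = permutation (λ i → index (T (e i))) (λ j → index (T⁻¹ (e j)))
      (λ j → e-injective _ _ (trans (e-index _) (trans (T-cong (e-index _)) (T∘T⁻¹ (e j)))))
      (λ i → e-injective _ _ (trans (e-index _) (trans (T⁻¹-cong (e-index _)) (T⁻¹∘T (e i)))))

    module _ {a ℓ′} (M : CommutativeMonoid a ℓ′) where
      open CommutativeMonoid M using () renaming (Carrier to A; _≈_ to _≈ᴹ_; trans to transᴹ)
      open import Algebra.Properties.CommutativeMonoid.Sum M using (sum; sum-permute; sum-cong-≋)

      sum-∘-bijection : (g : Carrier → A) → Congruent _≈_ _≈ᴹ_ g →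
                        sum (λ i → g (e i)) ≈ᴹ sum (λ i → g (T (e i)))
      sum-∘-bijection g g-cong = transᴹ (sum-permute (λ i → g (e i)) permute)
                                        (sum-cong-≋ {N} (λ i → g-cong (e-index (T (e i)))))

  module ∑ = Algebra.Properties.CommutativeMonoid.Sum +-commutativeMonoid
  module ∏ = Algebra.Properties.CommutativeMonoid.Sum *-commutativeMonoid

  N·1≈0 : N · 1# ≈ 0#
  N·1≈0 = identityˡ-unique (N · 1#) (∑.sum e) (sym (begin
    ∑.sum e                          ≈⟨ sum-∘-bijection (1# +_) (- 1# +_) +-congˡ +-congˡ
                                          (\\-leftDividesˡ 1#) (\\-leftDividesʳ 1#)
                                          +-commutativeMonoid (λ y → y) (λ y≈z → y≈z) ⟩
    ∑.sum (λ i → 1# + e i)           ≈⟨ ∑.∑-distrib-+ (λ _ → 1#) e ⟩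
    ∑.sum {N} (λ _ → 1#) + ∑.sum e   ≈⟨ +-congʳ (∑.sum-replicate N) ⟩
    N · 1# + ∑.sum e                 ∎))

  pow≈0⇒≈0 : ∀ {x} k → pow x k ≈ 0# → x ≈ 0#
  pow≈0⇒≈0 {x} k xᵏ≈0 with x ≟ 0#
  ... | yes x≈0 = x≈0
  ... | no  x≉0 = contradiction xᵏ≈0 (pow-≉0 k x≉0)

  ∏-scale : ∀ m x (f : Fin m → Carrier) → ∏.sum (λ i → x * f i) ≈ pow x m * ∏.sum f
  ∏-scale zero    x f = sym (*-identityˡ 1#)
  ∏-scale (suc m) x f = begin
    (x * f Fin.zero) * ∏.sum (λ i → x * f (Fin.suc i))   ≈⟨ *-congˡ (∏-scale m x (λ i → f (Fin.suc i))) ⟩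
    (x * f Fin.zero) * (pow x m * ∏.sum (λ i → f (Fin.suc i)))
      ≈⟨ solve 4 (λ a b c d → (a :* b) :* (c :* d) := (a :* c) :* (b :* d)) refl x _ _ _ ⟩
    (x * pow x m) * (f Fin.zero * ∏.sum (λ i → f (Fin.suc i))) ∎

  ∏-scale-except : ∀ m x (g h : Fin m → Carrier) (i₀ : Fin m) →
                   (∀ i → i ≢ i₀ → g i ≈ x * h i) → g i₀ ≈ h i₀ → x * ∏.sum g ≈ pow x m * ∏.sum h
  ∏-scale-except (suc m) x g h i₀ g≈xh gᵢ₀≈hᵢ₀ = begin
    x * ∏.sum g                                    ≈⟨ *-congˡ (∏.sum-remove {i = i₀} g) ⟩
    x * (g i₀ * ∏.sum (removeAt g i₀))             ≈⟨ *-congˡ (*-cong gᵢ₀≈hᵢ₀ (trans (∏.sum-cong-≋ {m} rest)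
                                                                                (∏-scale m x (removeAt h i₀)))) ⟩
    x * (h i₀ * (pow x m * ∏.sum (removeAt h i₀)))
      ≈⟨ solve 4 (λ a b c d → a :* (b :* (c :* d)) := (a :* c) :* (b :* d)) refl x _ _ _ ⟩
    (x * pow x m) * (h i₀ * ∏.sum (removeAt h i₀)) ≈⟨ *-congˡ (∏.sum-remove {i = i₀} h) ⟨
    pow x (suc m) * ∏.sum h                        ∎
    where
    rest : ∀ j → removeAt g i₀ j ≈ x * removeAt h i₀ j
    rest j = g≈xh (Fin.punchIn i₀ j) (Fin.punchInᵢ≢i i₀ j)

  φ : Carrier → Carrier
  φ y with y ≟ 0#
  ... | yes _ = 1#
  ... | no  _ = y

  φ-≉0 : ∀ y → φ y ≉ 0#
  φ-≉0 y with y ≟ 0#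
  ... | yes _   = 1≉0
  ... | no  y≉0 = y≉0

  φ-zero : ∀ {y} → y ≈ 0# → φ y ≈ 1#
  φ-zero {y} y≈0 with y ≟ 0#
  ... | yes _   = refl
  ... | no  y≉0 = contradiction y≈0 y≉0

  φ-nonzero : ∀ {y} → y ≉ 0# → φ y ≈ y
  φ-nonzero {y} y≉0 with y ≟ 0#
  ... | yes y≈0 = contradiction y≈0 y≉0
  ... | no  _   = refl

  φ-cong : Congruent _≈_ _≈_ φ
  φ-cong {y} {z} y≈z = by-cases (z ≟ 0#)
    where
    by-cases : Dec (z ≈ 0#) → φ y ≈ φ z
    by-cases (yes z≈0) = trans (φ-zero (trans y≈z z≈0)) (sym (φ-zero z≈0))
    by-cases (no  z≉0) = trans (φ-nonzero (λ y≈0 → z≉0 (trans (sym y≈z) y≈0)))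
                               (trans y≈z (sym (φ-nonzero z≉0)))

  ∏-≉0 : ∀ m (f : Fin m → Carrier) → (∀ i → f i ≉ 0#) → ∏.sum f ≉ 0#
  ∏-≉0 zero    f _     = 1≉0
  ∏-≉0 (suc m) f f≉0 = *-≉0 (f≉0 Fin.zero) (∏-≉0 m (λ i → f (Fin.suc i)) (λ i → f≉0 (Fin.suc i)))

  -- Multiplication by x ≉ 0 permutes the elements; φ makes the product of all of them invertible.
  pow-N : ∀ x → pow x N ≈ x
  pow-N x with x ≟ 0#
  ... | yes x≈0 = trans (pow-congˡ N x≈0) (trans (pow-zeroˡ N {{Fin.nonZeroIndex (index 0#)}}) (sym x≈0))
  ... | no  x≉0 = sym (*-cancelˡ (∏-≉0 N (λ i → φ (e i)) (λ i → φ-≉0 (e i))) (begin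
    P * x                              ≈⟨ *-comm P x ⟩
    x * P                              ≈⟨ *-congˡ (sum-∘-bijection (x *_) (x ⁻¹[ x≉0 ] *_) *-congˡ *-congˡ
                                            (x*[x⁻¹*y]≈y x x≉0) (x⁻¹*[x*y]≈y x x≉0)
                                            *-commutativeMonoid φ φ-cong) ⟩
    x * ∏.sum (λ i → φ (x * e i))      ≈⟨ ∏-scale-except N x _ _ (index 0#) scaled at-zero ⟩
    pow x N * P                        ≈⟨ *-comm _ P ⟩
    P * pow x N                        ∎))
    where
    P = ∏.sum (λ i → φ (e i))
    scaled : ∀ i → i ≢ index 0# → φ (x * e i) ≈ x * φ (e i)
    scaled i i≢i₀ = trans (φ-nonzero (*-≉0 x≉0 eᵢ≉0)) (*-congˡ (sym (φ-nonzero eᵢ≉0)))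
      where
      eᵢ≉0 : e i ≉ 0#
      eᵢ≉0 eᵢ≈0 = i≢i₀ (e-injective _ _ (trans eᵢ≈0 (sym (e-index 0#))))
    at-zero : φ (x * e (index 0#)) ≈ φ (e (index 0#))
    at-zero = trans (φ-zero (trans (*-congˡ (e-index 0#)) (zeroʳ x))) (sym (φ-zero (e-index 0#)))

module FrobeniusTrace {c ℓ} (K : CommutativeRing c ℓ) (q n : ℕ) (q-primePower : IsPrimePower q)
                      (1≤n : 1 ≤ n) (isField : FieldDefs.IsField K) (card : FieldDefs.HasCard K (q ^ n)) where
  open CommutativeRing K
  open FieldDefs K
  open WithQ q n
  open CommutativeRingProperties K
  open FieldProperties K isField
  open FiniteFieldProperties K isField card
  open import Relation.Binary.Reasoning.Setoid setoid
  open import Algebra.Properties.Ring ring using (-‿distribˡ-*)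
  open import Algebra.Properties.Group +-group using (inverseʳ-unique; x∙y⁻¹≈ε⇒x≈y)
  open import Algebra.Properties.Semiring.Mult semiring using () renaming (_×_ to _·_)
  open import Function.Definitions using (Congruent)
  open import Algebra.Properties.CommutativeSemigroup *-commutativeSemigroup using (x∙yz≈y∙xz)
  import Data.Vec.Functional as Vector
  open import Relation.Nullary using (yes; no)

  p m : ℕ
  p = proj₁ q-primePower
  m = proj₁ (proj₂ q-primePower)

  p-prime : Prime p
  p-prime = proj₁ (proj₂ (proj₂ q-primePower))

  1≤m : 1 ≤ m
  1≤m = proj₁ (proj₂ (proj₂ (proj₂ q-primePower)))

  q≡p^m : q ≡ p ℕ.^ m
  q≡p^m = proj₂ (proj₂ (proj₂ (proj₂ q-primePower)))

  instance
    q≢0 : NonZero q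
    q≢0 = ≡.subst NonZero (≡.sym q≡p^m) (ℕ.m^n≢0 p m {{prime⇒nonZero p-prime}})

  1<q : 1 < q
  1<q = ≡.subst (1 <_) (≡.sym q≡p^m) (ℕ.<-≤-trans (prime⇒1<p p-prime)
          (ℕ.≤-trans (ℕ.≤-reflexive (≡.sym (ℕ.^-identityʳ p)))
                     (ℕ.^-monoʳ-≤ p {{prime⇒nonZero p-prime}} 1≤m)))

  p·1≈0 : p · 1# ≈ 0#
  p·1≈0 = pow≈0⇒≈0 (m ℕ.* n) (begin
    pow (p · 1#) (m ℕ.* n)   ≈⟨ ·1-homo-^ p (m ℕ.* n) ⟨
    (p ℕ.^ (m ℕ.* n)) · 1#   ≡⟨ ≡.cong (_· 1#) q^n≡p^mn ⟨
    (q ^ n) · 1#             ≈⟨ N·1≈0 ⟩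
    0#                       ∎)
    where
    q^n≡p^mn : q ^ n ≡ p ℕ.^ (m ℕ.* n)
    q^n≡p^mn = ≡.trans (≡.cong (ℕ._^ n) q≡p^m) (ℕ.^-*-assoc p m n)

  σ-cong : Congruent _≈_ _≈_ σ
  σ-cong = pow-congˡ q

  σ-+ : ∀ x y → σ (x + y) ≈ σ x + σ y
  σ-+ x y = ≡.subst (λ r → pow (x + y) r ≈ pow x r + pow y r) (≡.sym q≡p^m)
              (pow-+-prime^ p-prime p·1≈0 m x y)

  σ-* : ∀ x y → σ (x * y) ≈ σ x * σ y
  σ-* x y = pow-distrib-* x y q

  σ-0 : σ 0# ≈ 0#
  σ-0 = pow-zeroˡ q

  σ-1 : σ 1# ≈ 1#
  σ-1 = pow-identityˡ q

  σ-neg : ∀ x → σ (- x) ≈ - σ x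
  σ-neg x = inverseʳ-unique (σ x) (σ (- x)) (trans (sym (σ-+ x (- x))) (trans (σ-cong (-‿inverseʳ x)) σ-0))

  σ-sumFin : ∀ k (f : Fin k → Carrier) → σ (sumFin k f) ≈ sumFin k (λ i → σ (f i))
  σ-sumFin zero    f = σ-0
  σ-sumFin (suc k) f = trans (σ-+ _ _) (+-congˡ (σ-sumFin k (λ i → f (Fin.suc i))))

  σ^-cong : ∀ i → Congruent _≈_ _≈_ (σ^ i)
  σ^-cong zero    x≈y = x≈y
  σ^-cong (suc i) x≈y = σ-cong (σ^-cong i x≈y)

  σ^-+ : ∀ i x y → σ^ i (x + y) ≈ σ^ i x + σ^ i y
  σ^-+ zero    x y = refl
  σ^-+ (suc i) x y = trans (σ-cong (σ^-+ i x y)) (σ-+ _ _)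

  σ^-* : ∀ i x y → σ^ i (x * y) ≈ σ^ i x * σ^ i y
  σ^-* zero    x y = refl
  σ^-* (suc i) x y = trans (σ-cong (σ^-* i x y)) (σ-* _ _)

  σ^-0 : ∀ i → σ^ i 0# ≈ 0#
  σ^-0 zero    = refl
  σ^-0 (suc i) = trans (σ-cong (σ^-0 i)) σ-0

  σ^-∘ : ∀ i j x → σ^ i (σ^ j x) ≡ σ^ (i ℕ.+ j) x
  σ^-∘ zero    j x = ≡.refl
  σ^-∘ (suc i) j x = ≡.cong σ (σ^-∘ i j x)

  σ^-σ : ∀ i x → σ^ i (σ x) ≡ σ (σ^ i x)
  σ^-σ zero    x = ≡.refl
  σ^-σ (suc i) x = ≡.cong σ (σ^-σ i x)

  σ^≈pow : ∀ i x → σ^ i x ≈ pow x (q ^ i)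
  σ^≈pow zero    x = sym (*-identityʳ x)
  σ^≈pow (suc i) x = begin
    σ (σ^ i x)               ≈⟨ σ-cong (σ^≈pow i x) ⟩
    pow (pow x (q ^ i)) q    ≈⟨ pow-assocʳ x (q ^ i) q ⟩
    pow x (q ^ i ℕ.* q)      ≡⟨ ≡.cong (pow x) (ℕ.*-comm (q ^ i) q) ⟩
    pow x (q ^ suc i)        ∎

  σ^n≈id : ∀ x → σ^ n x ≈ x
  σ^n≈id x = trans (σ^≈pow n x) (pow-N x)

  Fq-0 : InFq 0#
  Fq-0 = σ-0

  Fq-1 : InFq 1#
  Fq-1 = σ-1

  Fq-+ : ∀ {a b} → InFq a → InFq b → InFq (a + b)
  Fq-+ a∈Fq b∈Fq = trans (σ-+ _ _) (+-cong a∈Fq b∈Fq)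

  Fq-neg : ∀ {a} → InFq a → InFq (- a)
  Fq-neg a∈Fq = trans (σ-neg _) (-‿cong a∈Fq)

  Fq-⁻¹ : ∀ {a} (a≉0 : a ≉ 0#) → InFq a → InFq (a ⁻¹[ a≉0 ])
  Fq-⁻¹ {a} a≉0 a∈Fq = *-cancelˡ a≉0 (begin
    a * σ (a ⁻¹[ a≉0 ])        ≈⟨ *-congʳ a∈Fq ⟨
    σ a * σ (a ⁻¹[ a≉0 ])      ≈⟨ σ-* _ _ ⟨
    σ (a * a ⁻¹[ a≉0 ])        ≈⟨ σ-cong (*-inverseʳ a a≉0) ⟩
    σ 1#                       ≈⟨ σ-1 ⟩
    1#                         ≈⟨ *-inverseʳ a a≉0 ⟨
    a * a ⁻¹[ a≉0 ]            ∎)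

  Fq-σ^ : ∀ {a} → InFq a → ∀ i → σ^ i a ≈ a
  Fq-σ^ a∈Fq zero    = refl
  Fq-σ^ a∈Fq (suc i) = trans (σ-cong (Fq-σ^ a∈Fq i)) a∈Fq

  Fq-δ : ∀ {t} (i j : Fin t) → InFq (δ i j)
  Fq-δ Fin.zero    Fin.zero    = Fq-1
  Fq-δ Fin.zero    (Fin.suc j) = Fq-0
  Fq-δ (Fin.suc i) Fin.zero    = Fq-0
  Fq-δ (Fin.suc i) (Fin.suc j) = Fq-δ i j

  Tr-cong : Congruent _≈_ _≈_ Tr
  Tr-cong x≈y = sumFin-cong n (λ i → σ^-cong (toℕ i) x≈y)

  Tr-+ : ∀ x y → Tr (x + y) ≈ Tr x + Tr y
  Tr-+ x y = trans (sumFin-cong n (λ i → σ^-+ (toℕ i) x y)) (sumFin-distrib-+ n _ _)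

  Tr-0 : Tr 0# ≈ 0#
  Tr-0 = trans (sumFin-cong n (λ i → σ^-0 (toℕ i))) (sumFin-zero n)

  Tr-scal : ∀ {a} → InFq a → ∀ x → Tr (a * x) ≈ a * Tr x
  Tr-scal a∈Fq x = trans (sumFin-cong n (λ i → trans (σ^-* (toℕ i) _ x) (*-congʳ (Fq-σ^ a∈Fq (toℕ i)))))
                         (sym (*-distribˡ-sumFin n _ _))

  Tr-σ : ∀ x → Tr (σ x) ≈ Tr x
  Tr-σ x = trans (sumFin-cong n (λ i → reflexive (σ^-σ (toℕ i) x)))
                 (sumFin-shift n (λ i → σ^ i x) (σ^n≈id x))

  Tr-σ^ : ∀ i x → Tr (σ^ i x) ≈ Tr x
  Tr-σ^ zero    x = refl
  Tr-σ^ (suc i) x = trans (Tr-σ (σ^ i x)) (Tr-σ^ i x)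

  Fq-Tr : ∀ x → InFq (Tr x)
  Fq-Tr x = begin
    σ (Tr x)                                ≈⟨ σ-sumFin n _ ⟩
    sumFin n (λ i → σ (σ^ (toℕ i) x))       ≈⟨ sumFin-cong n (λ i → reflexive (σ^-σ (toℕ i) x)) ⟨
    Tr (σ x)                                ≈⟨ Tr-σ x ⟩
    Tr x                                    ∎

  Tr-lincomb : ∀ k (a u : Fin k → Carrier) → (∀ i → InFq (a i)) →
               Tr (sumFin k (λ i → a i * u i)) ≈ sumFin k (λ i → a i * Tr (u i))
  Tr-lincomb zero    a u _    = Tr-0
  Tr-lincomb (suc k) a u a∈Fq = trans (Tr-+ _ _)
    (+-cong (Tr-scal (a∈Fq Fin.zero) (u Fin.zero))
            (Tr-lincomb k (λ i → a (Fin.suc i)) (λ i → u (Fin.suc i)) (λ i → a∈Fq (Fin.suc i))))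

  trPoly : ℕ → List Carrier
  trPoly zero    = []
  trPoly (suc k) = trPoly k ⊕ X^ (q ^ k)

  eval-trPoly : ∀ k x → eval (trPoly k) x ≈ sumFin k (λ i → σ^ (toℕ i) x)
  eval-trPoly zero    x = refl
  eval-trPoly (suc k) x = begin
    eval (trPoly k ⊕ X^ (q ^ k)) x                           ≈⟨ eval-⊕ (trPoly k) _ x ⟩
    eval (trPoly k) x + eval (X^ (q ^ k)) x                  ≈⟨ +-cong (eval-trPoly k x)
                                                                       (trans (eval-X^ (q ^ k) x) (sym (σ^≈pow k x))) ⟩
    sumFin k (λ i → σ^ (toℕ i) x) + σ^ k x                   ≈⟨ sumFin-last k (λ i → σ^ i x) ⟨
    sumFin (suc k) (λ i → σ^ (toℕ i) x)                      ∎

  length-trPoly : ∀ k → length (trPoly k) ≤ q ^ k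
  length-trPoly zero    = z≤n
  length-trPoly (suc k) = length-⊕ (trPoly k) (X^ (q ^ k))
    (ℕ.≤-trans (length-trPoly k) (ℕ.m≤n*m (q ^ k) q))
    (≡.subst (_≤ q ^ suc k) (≡.sym (length-X^ (q ^ k)))
      (≡.subst (q ^ k <_) (ℕ.*-comm (q ^ k) q) (ℕ.m<m*n (q ^ k) q {{ℕ.m^n≢0 q k}} 1<q)))

  Tr-≉0 : ∃[ w ] Tr w ≉ 0#
  Tr-≉0 = map e id (Fin.¬∀⟶∃¬ (q ^ n) (λ i → Tr (e i) ≈ 0#) (λ i → Tr (e i) ≟ 0#) Tr∘e-not-all-zero)
    where
    trPoly-not-allZero : ∀ k → 1 ≤ k → ¬ All (_≈ 0#) (trPoly k)
    trPoly-not-allZero (suc k) _ = 1≉0 ∘ allZero-⊕-X^⇒1≈0 (trPoly k) (q ^ k) (length-trPoly k)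
    Tr∘e-not-all-zero : ¬ (∀ i → Tr (e i) ≈ 0#)
    Tr∘e-not-all-zero Tr∘e≈0 = trPoly-not-allZero n 1≤n
      (roots⇒allZero (trPoly n) (q ^ n) (length-trPoly n) e e-injective
        (λ i → trans (eval-trPoly n (e i)) (Tr∘e≈0 i)))

  Tr-*-+ : ∀ b u v → Tr (b * (u + v)) ≈ Tr (b * u) + Tr (b * v)
  Tr-*-+ b u v = trans (Tr-cong (distribˡ b u v)) (Tr-+ _ _)

  Tr-*-scal : ∀ {a} → InFq a → ∀ b v → Tr (b * (a * v)) ≈ a * Tr (b * v)
  Tr-*-scal {a} a∈Fq b v = trans (Tr-cong (x∙yz≈y∙xz b a v)) (Tr-scal a∈Fq (b * v))

  Tr-*-lincomb : ∀ k b (a u : Fin k → Carrier) → (∀ i → InFq (a i)) →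
                 Tr (b * sumFin k (λ i → a i * u i)) ≈ sumFin k (λ i → a i * Tr (b * u i))
  Tr-*-lincomb k b a u a∈Fq = begin
    Tr (b * sumFin k (λ i → a i * u i))    ≈⟨ Tr-cong (*-distribˡ-sumFin k b _) ⟩
    Tr (sumFin k (λ i → b * (a i * u i)))  ≈⟨ Tr-cong (sumFin-cong k (λ i → x∙yz≈y∙xz b (a i) (u i))) ⟩
    Tr (sumFin k (λ i → a i * (b * u i)))  ≈⟨ Tr-lincomb k a (λ i → b * u i) a∈Fq ⟩
    sumFin k (λ i → a i * Tr (b * u i))    ∎

  Tr-nondegenerate : ∀ {γ} → γ ≉ 0# → ∃[ z ] Tr (γ * z) ≈ 1#
  Tr-nondegenerate {γ} γ≉0 with Tr-≉0
  ... | w , Trw≉0 = γ ⁻¹[ γ≉0 ] * (v⁻¹ * w) , (begin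
    Tr (γ * (γ ⁻¹[ γ≉0 ] * (v⁻¹ * w)))  ≈⟨ Tr-cong (x*[x⁻¹*y]≈y γ γ≉0 _) ⟩
    Tr (v⁻¹ * w)                        ≈⟨ Tr-scal (Fq-⁻¹ Trw≉0 (Fq-Tr w)) w ⟩
    v⁻¹ * Tr w                          ≈⟨ *-comm _ _ ⟩
    Tr w * v⁻¹                          ≈⟨ *-inverseʳ (Tr w) Trw≉0 ⟩
    1#                                  ∎)
    where
    v⁻¹ = Tr w ⁻¹[ Trw≉0 ]

  LinIndep-tail : ∀ {t} (β : Fin (suc t) → Carrier) → LinIndep (suc t) β → LinIndep t (λ j → β (Fin.suc j))
  LinIndep-tail β li a a∈Fq Σ≈0 j =
    li (0# Vector.∷ a) (λ { Fin.zero → Fq-0 ; (Fin.suc i) → a∈Fq i })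
       (trans (+-cong (zeroˡ _) Σ≈0) (+-identityˡ 0#)) (Fin.suc j)

  LinIndep-unique : ∀ {t} {v : Fin t → Carrier} → LinIndep t v → ∀ {a b : Fin t → Carrier} →
                    (∀ j → InFq (a j)) → (∀ j → InFq (b j)) →
                    sumFin t (λ j → a j * v j) ≈ sumFin t (λ j → b j * v j) → ∀ j → a j ≈ b j
  LinIndep-unique {t} {v} li {a} {b} a∈Fq b∈Fq Σa≈Σb j =
    x∙y⁻¹≈ε⇒x≈y (a j) (b j) (li (λ j → a j - b j) (λ j → Fq-+ (a∈Fq j) (Fq-neg (b∈Fq j))) (begin
      sumFin t (λ j → (a j - b j) * v j)                   ≈⟨ sumFin-cong t (λ j → trans (distribʳ _ _ _)
                                                                (+-congˡ (sym (-‿distribˡ-* _ _)))) ⟩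
      sumFin t (λ j → a j * v j + - (b j * v j))           ≈⟨ sumFin-distrib-+ t _ _ ⟩
      sumFin t (λ j → a j * v j) + sumFin t (λ j → - (b j * v j)) ≈⟨ +-congˡ (sumFin-negate t _) ⟩
      sumFin t (λ j → a j * v j) - sumFin t (λ j → b j * v j)     ≈⟨ +-congʳ Σa≈Σb ⟩
      sumFin t (λ j → b j * v j) - sumFin t (λ j → b j * v j)     ≈⟨ -‿inverseʳ _ ⟩
      0#                                                   ∎) j)

  DualBasis : ∀ {t} → (Fin t → Carrier) → (Fin t → Carrier) → Set ℓ
  DualBasis β y = ∀ i j → Tr (β j * y i) ≈ δ j i

  -- γ = β₀ − Σ κ_k β′_k is nonzero by independence; pick z with Tr (γ z) = 1 and remove its
  -- components along the dual basis y′ of β′.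
  dual-head : ∀ {t} (β : Fin (suc t) → Carrier) → LinIndep (suc t) β →
              (y′ : Fin t → Carrier) → DualBasis (λ j → β (Fin.suc j)) y′ →
              ∃[ z′ ] (Tr (β Fin.zero * z′) ≈ 1# × (∀ j → Tr (β (Fin.suc j) * z′) ≈ 0#))
  dual-head {t} β li y′ y′-dual = z′ , β₀z′≈1 , β′z′≈0
    where
    β₀ = β Fin.zero
    β′ : Fin t → Carrier
    β′ j = β (Fin.suc j)
    κ : Fin t → Carrier
    κ k = Tr (β₀ * y′ k)
    a : Fin (suc t) → Carrier
    a = 1# Vector.∷ (λ k → - κ k)
    a∈Fq : ∀ j → InFq (a j)
    a∈Fq Fin.zero    = Fq-1
    a∈Fq (Fin.suc k) = Fq-neg (Fq-Tr _)
    γ = sumFin (suc t) (λ j → a j * β j)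
    γ≉0 : γ ≉ 0#
    γ≉0 γ≈0 = 1≉0 (li a a∈Fq γ≈0 Fin.zero)
    z = proj₁ (Tr-nondegenerate γ≉0)
    d : Fin t → Carrier
    d k = - Tr (β′ k * z)
    d∈Fq : ∀ k → InFq (d k)
    d∈Fq k = Fq-neg (Fq-Tr _)
    z′ = z + sumFin t (λ k → d k * y′ k)
    β′z′≈0 : ∀ j → Tr (β′ j * z′) ≈ 0#
    β′z′≈0 j = begin
      Tr (β′ j * z′)                                         ≈⟨ Tr-*-+ _ _ _ ⟩
      Tr (β′ j * z) + Tr (β′ j * sumFin t (λ k → d k * y′ k)) ≈⟨ +-congˡ (Tr-*-lincomb t (β′ j) d y′ d∈Fq) ⟩
      Tr (β′ j * z) + sumFin t (λ k → d k * Tr (β′ j * y′ k)) ≈⟨ +-congˡ (sumFin-cong t (λ k →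
                                                                    trans (*-congˡ (y′-dual k j)) (*-comm _ _))) ⟩
      Tr (β′ j * z) + sumFin t (λ k → δ j k * d k)           ≈⟨ +-congˡ (sumFin-δ t j d) ⟩
      Tr (β′ j * z) - Tr (β′ j * z)                          ≈⟨ -‿inverseʳ _ ⟩
      0#                                                     ∎
    dκ≈[-κ]Tr : ∀ k → d k * κ k ≈ - κ k * Tr (z * β′ k)
    dκ≈[-κ]Tr k = begin
      - Tr (β′ k * z) * κ k    ≈⟨ -‿distribˡ-* _ _ ⟨
      - (Tr (β′ k * z) * κ k)  ≈⟨ -‿cong (trans (*-comm _ _) (*-congˡ (Tr-cong (*-comm _ _)))) ⟩
      - (κ k * Tr (z * β′ k))  ≈⟨ -‿distribˡ-* _ _ ⟩
      - κ k * Tr (z * β′ k)    ∎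
    β₀z′≈1 : Tr (β₀ * z′) ≈ 1#
    β₀z′≈1 = begin
      Tr (β₀ * z′)                                            ≈⟨ Tr-*-+ _ _ _ ⟩
      Tr (β₀ * z) + Tr (β₀ * sumFin t (λ k → d k * y′ k))      ≈⟨ +-congˡ (Tr-*-lincomb t β₀ d y′ d∈Fq) ⟩
      Tr (β₀ * z) + sumFin t (λ k → d k * κ k)                ≈⟨ +-cong (trans (Tr-cong (*-comm _ _)) (sym (*-identityˡ _)))
                                                                        (sumFin-cong t dκ≈[-κ]Tr) ⟩
      sumFin (suc t) (λ j → a j * Tr (z * β j))               ≈⟨ Tr-*-lincomb (suc t) z a β a∈Fq ⟨
      Tr (z * γ)                                              ≈⟨ Tr-cong (*-comm z γ) ⟩
      Tr (γ * z)                                              ≈⟨ proj₂ (Tr-nondegenerate γ≉0) ⟩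
      1#                                                      ∎

  dualBasis : ∀ t (β : Fin t → Carrier) → LinIndep t β → ∃[ y ] DualBasis β y
  dualBasis zero    β _  = (λ ()) , λ ()
  dualBasis (suc t) β li with dualBasis t (λ j → β (Fin.suc j)) (LinIndep-tail β li)
  ... | y′ , y′-dual with dual-head β li y′ y′-dual
  ...   | z′ , β₀z′≈1 , β′z′≈0 = z′ Vector.∷ (λ k → y′ k + - κ k * z′) , dual
    where
    κ : Fin t → Carrier
    κ k = Tr (β Fin.zero * y′ k)
    dual : DualBasis β (z′ Vector.∷ (λ k → y′ k + - κ k * z′))
    dual Fin.zero    Fin.zero    = β₀z′≈1
    dual Fin.zero    (Fin.suc j) = β′z′≈0 j
    dual (Fin.suc k) Fin.zero    = begin
      Tr (β Fin.zero * (y′ k + - κ k * z′))     ≈⟨ Tr-*-+ _ _ _ ⟩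
      κ k + Tr (β Fin.zero * (- κ k * z′))      ≈⟨ +-congˡ (Tr-*-scal (Fq-neg (Fq-Tr _)) _ z′) ⟩
      κ k + - κ k * Tr (β Fin.zero * z′)        ≈⟨ +-congˡ (trans (*-congˡ β₀z′≈1) (*-identityʳ _)) ⟩
      κ k - κ k                                 ≈⟨ -‿inverseʳ _ ⟩
      0#                                        ∎
    dual (Fin.suc k) (Fin.suc j) = begin
      Tr (β (Fin.suc j) * (y′ k + - κ k * z′))  ≈⟨ Tr-*-+ _ _ _ ⟩
      Tr (β (Fin.suc j) * y′ k) + Tr (β (Fin.suc j) * (- κ k * z′))
        ≈⟨ +-cong (y′-dual k j) (Tr-*-scal (Fq-neg (Fq-Tr _)) _ z′) ⟩
      δ j k + - κ k * Tr (β (Fin.suc j) * z′)   ≈⟨ +-congˡ (trans (*-congˡ (β′z′≈0 j)) (zeroʳ _)) ⟩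
      δ j k + 0#                                ≈⟨ +-identityʳ _ ⟩
      δ j k                                     ∎

  Tr-pairing-surjective : ∀ {t} (β : Fin t → Carrier) → LinIndep t β →
                          (x : Fin t → Carrier) → (∀ j → InFq (x j)) → ∃[ y ] (∀ j → Tr (β j * y) ≈ x j)
  Tr-pairing-surjective {t} β li x x∈Fq with dualBasis t β li
  ... | y , dual = sumFin t (λ i → x i * y i) , λ j → begin
    Tr (β j * sumFin t (λ i → x i * y i))  ≈⟨ Tr-*-lincomb t (β j) x y x∈Fq ⟩
    sumFin t (λ i → x i * Tr (β j * y i))  ≈⟨ sumFin-cong t (λ i → trans (*-congˡ (dual i j)) (*-comm _ _)) ⟩
    sumFin t (λ i → δ j i * x i)           ≈⟨ sumFin-δ t j x ⟩
    x j                                    ∎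

  Tr-σ^-* : ∀ i a b → Tr (σ^ i a * σ^ i b) ≈ Tr (a * b)
  Tr-σ^-* i a b = trans (Tr-cong (sym (σ^-* i a b))) (Tr-σ^ i (a * b))

  covering⇔ : ∀ α → CyclicallyCovering (V α) ⇔ (∀ y → ∃[ i ] (i < n × Tr (σ^ i α * y) ≈ 0#))
  covering⇔ α = mk⇔ to from
    where
    to : CyclicallyCovering (V α) → ∀ y → ∃[ i ] (i < n × Tr (σ^ i α * y) ≈ 0#)
    to cover y with cover y
    ... | i , i<n , u , Tr[αu]≈0 , σ^iu≈y =
      i , i<n , trans (Tr-cong (*-congˡ (sym σ^iu≈y))) (trans (Tr-σ^-* i α u) Tr[αu]≈0)
    from : (∀ y → ∃[ i ] (i < n × Tr (σ^ i α * y) ≈ 0#)) → CyclicallyCovering (V α)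
    from zeros y with zeros y
    ... | i , i<n , Tr≈0 = i , i<n , u , Vu , σ^iu≈y
      where
      u = σ^ (n ∸ i) y
      σ^iu≈y : σ^ i u ≈ y
      σ^iu≈y = trans (reflexive (≡.trans (σ^-∘ i (n ∸ i) y)
                                          (≡.cong (λ j → σ^ j y) (ℕ.m+[n∸m]≡n (ℕ.<⇒≤ i<n)))))
                     (σ^n≈id y)
      Vu : V α u
      Vu = trans (sym (Tr-σ^-* i α u)) (trans (Tr-cong (*-congˡ σ^iu≈y)) Tr≈0)

  linIndep⇒¬covering : ∀ α → LinIndep n (λ i → σ^ (toℕ i) α) → ¬ CyclicallyCovering (V α)
  linIndep⇒¬covering α li cover with Equivalence.to (covering⇔ α) cover 1#
  ... | i , _ , Tr[σ^iα]≈0 = 1≉0 (li (λ _ → 1#) (λ _ → Fq-1) Σ≈0 (fromℕ< 1≤n))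
    where
    Σ≈0 : sumFin n (λ j → 1# * σ^ (toℕ j) α) ≈ 0#
    Σ≈0 = begin
      sumFin n (λ j → 1# * σ^ (toℕ j) α)   ≈⟨ sumFin-cong n (λ j → *-identityˡ _) ⟩
      Tr α                                 ≈⟨ Tr-σ^ i α ⟨
      Tr (σ^ i α)                          ≈⟨ Tr-cong (*-identityʳ _) ⟨
      Tr (σ^ i α * 1#)                     ≈⟨ Tr[σ^iα]≈0 ⟩
      0#                                   ∎

  module CoveringCriterion (α : Carrier) (t : ℕ) (t≤n : t ≤ n) (li : LinIndep t (λ j → σ^ (toℕ j) α))
                (k : ℕ → Fin t → Carrier) (k∈Fq : ∀ i j → InFq (k i j))
                (k-expansion : ∀ i → i < n → σ^ i α ≈ sumFin t (λ j → k i j * σ^ (toℕ j) α)) where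

    β : Fin t → Carrier
    β j = σ^ (toℕ j) α

    Tr-expand : ∀ i → i < n → ∀ {y} {x : Fin t → Carrier} → (∀ j → Tr (β j * y) ≈ x j) →
                Tr (σ^ i α * y) ≈ sumFin t (λ j → k i j * x j)
    Tr-expand i i<n {y} {x} Tr[βy]≈x = begin
      Tr (σ^ i α * y)                          ≈⟨ Tr-cong (*-comm _ _) ⟩
      Tr (y * σ^ i α)                          ≈⟨ Tr-cong (*-congˡ (k-expansion i i<n)) ⟩
      Tr (y * sumFin t (λ j → k i j * β j))    ≈⟨ Tr-*-lincomb t y (k i) β (k∈Fq i) ⟩
      sumFin t (λ j → k i j * Tr (y * β j))
        ≈⟨ sumFin-cong t (λ j → *-congˡ (trans (Tr-cong (*-comm _ _)) (Tr[βy]≈x j))) ⟩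
      sumFin t (λ j → k i j * x j)             ∎

    k≈δ : ∀ i j → k (toℕ i) j ≈ δ i j
    k≈δ i = LinIndep-unique li (k∈Fq (toℕ i)) (Fq-δ i) (begin
      sumFin t (λ j → k (toℕ i) j * β j)   ≈⟨ k-expansion (toℕ i) (ℕ.<-≤-trans (Fin.toℕ<n i) t≤n) ⟨
      β i                                  ≈⟨ sumFin-δ t i β ⟨
      sumFin t (λ j → δ i j * β j)         ∎)

    sumFin-k-below-t : ∀ {i} (i<t : i < t) (x : Fin t → Carrier) →
                       sumFin t (λ j → k i j * x j) ≈ x (fromℕ< i<t)
    sumFin-k-below-t {i} i<t x = begin
      sumFin t (λ j → k i j * x j)
        ≡⟨ ≡.cong (λ i′ → sumFin t (λ j → k i′ j * x j)) (Fin.toℕ-fromℕ< i<t) ⟨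
      sumFin t (λ j → k (toℕ j₀) j * x j)   ≈⟨ sumFin-cong t (λ j → *-congʳ (k≈δ j₀ j)) ⟩
      sumFin t (λ j → δ j₀ j * x j)         ≈⟨ sumFin-δ t j₀ x ⟩
      x j₀                                  ∎
      where
      j₀ = fromℕ< i<t

    Condition : Set _
    Condition = (x : Fin t → Carrier) → (∀ j → InFq (x j)) → (∀ j → ¬ (x j ≈ 0#)) →
                ∃[ i ] (t ≤ i × i < n × sumFin t (λ j → k i j * x j) ≈ 0#)

    covering⇒condition : CyclicallyCovering (V α) → Condition
    covering⇒condition cover x x∈Fq x≉0 with Tr-pairing-surjective β li x x∈Fq
    ... | y , Tr[βy]≈x with Equivalence.to (covering⇔ α) cover y
    ...   | i , i<n , Tr≈0 with i ℕ.<? t | trans (sym (Tr-expand i i<n Tr[βy]≈x)) Tr≈0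
    ...     | no  i≮t | Σkx≈0 = i , ℕ.≮⇒≥ i≮t , i<n , Σkx≈0
    ...     | yes i<t | Σkx≈0 =
      contradiction (trans (sym (sumFin-k-below-t i<t x)) Σkx≈0) (x≉0 (fromℕ< i<t))

    -- If some Tr (β_j y) vanishes, j itself is a witness; otherwise apply the condition to them.
    condition⇒covering : Condition → CyclicallyCovering (V α)
    condition⇒covering condition = Equivalence.from (covering⇔ α) zeros
      where
      zeros : ∀ y → ∃[ i ] (i < n × Tr (σ^ i α * y) ≈ 0#)
      zeros y with Fin.any? (λ j → Tr (β j * y) ≟ 0#)
      ... | yes (j , Tr≈0) = toℕ j , ℕ.<-≤-trans (Fin.toℕ<n j) t≤n , Tr≈0
      ... | no  none with condition (λ j → Tr (β j * y)) (λ j → Fq-Tr _) (λ j Tr≈0 → none (j , Tr≈0))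
      ...   | i , _ , i<n , Σ≈0 = i , i<n , trans (Tr-expand i i<n (λ j → refl)) Σ≈0

theorem3p4 : ∀ {c ℓ : Level} (K : CommutativeRing c ℓ) (q n : ℕ) →
    IsPrimePower q → 1 ≤ n →
    let open CommutativeRing K
        open FieldDefs K
        open WithQ q n
    in IsField → HasCard (q ^ n) →
      ((α : Carrier) → ¬ (α ≈ 0#) →
        LinIndep n (λ i → σ^ (toℕ i) α) → ¬ CyclicallyCovering (V α))
      ×
      ((α : Carrier) → ¬ (α ≈ 0#) → (t : ℕ) → t ≤ n →
        LinIndep t (λ j → σ^ (toℕ j) α) →
        (k : ℕ → Fin t → Carrier) →
        (∀ i j → InFq (k i j)) →
        (∀ i → i < n → σ^ i α ≈ sumFin t (λ j → k i j * σ^ (toℕ j) α)) →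
        (CyclicallyCovering (V α) ⇔
          ((x : Fin t → Carrier) → (∀ j → InFq (x j)) → (∀ j → ¬ (x j ≈ 0#)) →
            ∃[ i ] (t ≤ i × i < n × sumFin t (λ j → k i j * x j) ≈ 0#))))
theorem3p4 K q n q-primePower 1≤n isField card =
  (λ α _ → linIndep⇒¬covering α) ,
  λ α _ t t≤n li k k∈Fq k-expansion →
    let open CoveringCriterion α t t≤n li k k∈Fq k-expansion
    in mk⇔ covering⇒condition condition⇒covering
  where
  open FrobeniusTrace K q n q-primePower 1≤n isField card
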